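{- Let $n\ge2$, $m\ge1$, and let $T\in\mathrm{Bi}(m,n)$ be equipped with an orientation. Let $v$ be an external vertex of $T$. Then there exist a unique external vertex $w$ and a unique reduced, well oriented path from $v$ to $w$.
   Context: $\mathrm{Bi}(m,n)$ denotes the set of finite trees all of whose vertices have valence $1$ (external) or $n$ (internal) and which have exactly $m$ internal vertices. An orientation of $T$ is the choice, for each internal vertex $u$, of an $n$-cycle $\sigma_u$ permuting the $n$ vertices adjacent to $u$. A path $(u_0,u_1,\dots,u_k)$ of adjacent vertices is reduced if $u_{j-1}\ne u_{j+1}$ for all $j$, and it is well oriented if $\sigma_{u_j}(u_{j-1})=u_{j+1}$ for every $0<j<k$ (each such $u_j$ being internal). -}

module Defs where

open import Data.Nat using (ℕ; zero; suc; _≤_; _≡ᵇ_)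
open import Data.Bool using (Bool; true; false; if_then_else_; T)
open import Data.Fin using (Fin)
open import Data.List using (List; []; _∷_; map; allFin; length; head; last)
open import Data.Nat.ListAction using (sum)
open import Data.Sum using (_⊎_)
open import Data.List.Relation.Unary.Linked using (Linked)
open import Data.List.Relation.Unary.Unique.Propositional using (Unique)
open import Data.Maybe using (Maybe; just)
open import Data.Product using (Σ; ∃; _×_; _,_)
open import Data.Unit using (⊤)
open import Relation.Binary.PropositionalEquality using (_≡_; _≢_)
open import Relation.Nullary using (¬_)

record Graph (N : ℕ) : Set where
  field
    adj     : Fin N → Fin N → Bool
    sym     : ∀ u v → adj u v ≡ adj v u
    irrefl  : ∀ u → adj u u ≡ false

module _ {N : ℕ} (G : Graph N) where
  open Graph G

  Adj : Fin N → Fin N → Set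
  Adj u v = T (adj u v)

  degree : Fin N → ℕ
  degree u = sum (map (λ x → if adj u x then 1 else 0) (allFin N))

  WalkFromTo : Fin N → Fin N → List (Fin N) → Set
  WalkFromTo u v xs = head xs ≡ just u × last xs ≡ just v × Linked Adj xs

  Connected : Set
  Connected = ∀ u v → ∃ λ xs → WalkFromTo u v xs

  IsCycle : List (Fin N) → Set
  IsCycle xs = Σ (Fin N) λ x₀ → Σ (Fin N) λ xₗ →
    3 ≤ length xs × Unique xs × Linked Adj xs ×
    head xs ≡ just x₀ × last xs ≡ just xₗ × Adj xₗ x₀

  IsTree : Set
  IsTree = Connected × (∀ xs → ¬ IsCycle xs)

  Internal : ℕ → Fin N → Set
  Internal n u = degree u ≡ n

  External : Fin N → Set
  External u = degree u ≡ 1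

  #internal : ℕ → ℕ
  #internal n = sum (map (λ u → if degree u ≡ᵇ n then 1 else 0) (allFin N))

  InBi : ℕ → ℕ → Set
  InBi m n = IsTree × (∀ u → degree u ≡ 1 ⊎ degree u ≡ n) × #internal n ≡ m

_^[_] : {A : Set} → (A → A) → ℕ → A → A
(f ^[ zero ]) x  = x
(f ^[ suc k ]) x = f ((f ^[ k ]) x)

module _ {N : ℕ} (G : Graph N) (n : ℕ) where

  -- σ is an n-cycle on the (n-element) set of neighbours of the internal
  -- vertex u: it maps neighbours to neighbours, is injective there, and the
  -- neighbours form a single orbit.  (Values on non-neighbours are irrelevant.)
  IsCycleOnNeighbours : Fin N → (Fin N → Fin N) → Set
  IsCycleOnNeighbours u σ =
    (∀ x → Adj G u x → Adj G u (σ x)) ×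
    (∀ x y → Adj G u x → Adj G u y → σ x ≡ σ y → x ≡ y) ×
    (∀ x y → Adj G u x → Adj G u y → ∃ λ k → (σ ^[ k ]) x ≡ y)

  Orientation : Set
  Orientation = Σ (Fin N → Fin N → Fin N) λ σ →
    ∀ u → Internal G n u → IsCycleOnNeighbours u (σ u)

AllTriples : {A : Set} → (A → A → A → Set) → List A → Set
AllTriples P (x ∷ y ∷ z ∷ rest) = P x y z × AllTriples P (y ∷ z ∷ rest)
AllTriples P _ = ⊤

module _ {N : ℕ} (G : Graph N) (n : ℕ) (o : Orientation G n) where
  open import Data.Product using (proj₁)

  σ : Fin N → Fin N → Fin N
  σ = proj₁ o

  Reduced : List (Fin N) → Set
  Reduced = AllTriples (λ a b c → a ≢ c)

  WellOriented : List (Fin N) → Set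
  WellOriented = AllTriples (λ a b c → Internal G n b × σ b a ≡ c)

  RWOPath : Fin N → Fin N → List (Fin N) → Set
  RWOPath v w xs = WalkFromTo G v w xs × Reduced xs × WellOriented xs

-- Starting from the unique neighbour u of v, the orientation determines the walk
-- v, u, σ_u v, …, which can stop only at a non-internal, i.e. external, vertex.
-- Since σ has no fixed points (n ≥ 2), this walk never backtracks, and in a tree a
-- walk without backtracking never repeats a vertex; so it has at most N vertices and
-- must stop.  Conversely, a well oriented path out of v is forced to follow this walk at
-- every step and cannot end at an internal vertex, so it is this walk.
module Submission where

open import Defs
open import Data.Nat using (ℕ; zero; suc; _+_; _≤_; _≟_; s≤s; z≤n)
open import Data.Nat.Properties using (suc-injective; 1+n≢0; <⇒≢; <⇒≱; ≤-reflexive; ≤-trans; n≤1+n; 1+n≰n)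
open import Data.Bool using (Bool; true; false; if_then_else_; T)
open import Data.Fin using (Fin; zero; suc)
import Data.Fin.Properties as Fin
open import Data.List using (List; []; _∷_; _++_; tabulate; lookup; length; last)
open import Data.List.Properties using (map-tabulate)
open import Data.List.Membership.Propositional using (_∉_)
open import Data.List.Membership.Propositional.Properties using (∈-lookup; ∈-∃++)
open import Data.Nat.ListAction using (sum)
open import Data.List.Relation.Unary.All as All using (All; []; _∷_)
open import Data.List.Relation.Unary.All.Properties using (¬Any⇒All¬; ++⁻ˡ; ++⁻ʳ)
open import Data.List.Relation.Unary.AllPairs using ([]; _∷_)
open import Data.List.Relation.Unary.Linked as Linked using (Linked; []; [-]; _∷_)
open import Data.List.Relation.Unary.Unique.Propositional using (Unique)
open import Data.Maybe using (just)
open import Data.Maybe.Properties using (just-injective)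
open import Data.Product using (Σ; ∃; _×_; _,_; proj₁; proj₂; uncurry)
open import Data.Sum using (_⊎_; inj₁; inj₂; [_,_]′)
import Data.Sum as Sum
open import Data.Empty using (⊥-elim)
open import Data.Unit using (tt)
open import Function using (_∘_; id)
open import Relation.Binary.PropositionalEquality using (_≡_; _≢_; refl; sym; trans; cong; subst; ≢-sym)
open import Relation.Nullary using (¬_; yes; no)

^[]-fixed : ∀ {A : Set} {f : A → A} {x : A} → f x ≡ x → ∀ k → (f ^[ k ]) x ≡ x
^[]-fixed         fx≡x zero    = refl
^[]-fixed {f = f} fx≡x (suc k) = trans (cong f (^[]-fixed fx≡x k)) fx≡x

All-last : ∀ {A : Set} {P : A → Set} {xs : List A} {w : A} → All P xs → last xs ≡ just w → P w
All-last (px ∷ [])          refl  = px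
All-last (_ ∷ pxs@(_ ∷ _)) last≡ = All-last pxs last≡

AllTriples-tail : ∀ {A : Set} {P : A → A → A → Set} {x : A} xs → AllTriples P (x ∷ xs) → AllTriples P xs
AllTriples-tail []          _        = tt
AllTriples-tail (_ ∷ [])    _        = tt
AllTriples-tail (_ ∷ _ ∷ _) (_ , ps) = ps

Linked[x∷xs++y∷ys]⇒closed : ∀ {A : Set} {R : A → A → Set} {x y : A} xs {ys} →
                             Linked R (x ∷ xs ++ y ∷ ys) →
                             Linked R (x ∷ xs) × ∃ λ z → last (x ∷ xs) ≡ just z × R z y
Linked[x∷xs++y∷ys]⇒closed []       (Rxy ∷ _) = [-] , _ , refl , Rxy
Linked[x∷xs++y∷ys]⇒closed (_ ∷ xs) (Rxx′ ∷ Rs) with Linked[x∷xs++y∷ys]⇒closed xs Rs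
... | Rs′ , z , last≡ , Rzy = Rxx′ ∷ Rs′ , z , last≡ , Rzy

Unique[xs++y∷ys]⇒Unique[y∷xs] : ∀ {A : Set} xs {y : A} {ys} → Unique (xs ++ y ∷ ys) → Unique (y ∷ xs)
Unique[xs++y∷ys]⇒Unique[y∷xs] []       _          = [] ∷ []
Unique[xs++y∷ys]⇒Unique[y∷xs] (x ∷ xs) (x∉ ∷ xs!) with Unique[xs++y∷ys]⇒Unique[y∷xs] xs xs!
... | y∉xs ∷ xs!′ = (≢-sym (All.head (++⁻ʳ xs x∉)) ∷ y∉xs) ∷ ++⁻ˡ xs x∉ ∷ xs!′

Unique⇒lookup-injective : ∀ {A : Set} {xs : List A} → Unique xs →
                          ∀ i j → lookup xs i ≡ lookup xs j → i ≡ j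
Unique⇒lookup-injective {xs = _ ∷ _} _          zero    zero    _  = refl
Unique⇒lookup-injective {xs = _ ∷ _} (x∉xs ∷ _) zero    (suc j) eq =
  ⊥-elim (All.lookup x∉xs (∈-lookup j) eq)
Unique⇒lookup-injective {xs = _ ∷ _} (x∉xs ∷ _) (suc i) zero    eq =
  ⊥-elim (All.lookup x∉xs (∈-lookup i) (sym eq))
Unique⇒lookup-injective {xs = _ ∷ _} (_ ∷ xs!)  (suc i) (suc j) eq =
  cong suc (Unique⇒lookup-injective xs! i j eq)

Unique⇒length≤ : ∀ {N} {xs : List (Fin N)} → Unique xs → length xs ≤ N
Unique⇒length≤ xs! = Fin.injective⇒≤ (Unique⇒lookup-injective xs! _ _)

count : ∀ {N} → (Fin N → Bool) → ℕ
count p = sum (tabulate (λ i → if p i then 1 else 0))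

count≡0⇒none : ∀ {N} (p : Fin N → Bool) → count p ≡ 0 → ∀ i → ¬ T (p i)
count≡0⇒none p c zero t with p zero
... | true  = 1+n≢0 c
... | false = t
count≡0⇒none p c (suc i) t with p zero
... | true  = 1+n≢0 c
... | false = count≡0⇒none (p ∘ suc) c i t

none⇒count≡0 : ∀ {N} (p : Fin N → Bool) → (∀ i → ¬ T (p i)) → count p ≡ 0
none⇒count≡0 {zero}  p none = refl
none⇒count≡0 {suc N} p none with p zero | none zero
... | true  | ¬t = ⊥-elim (¬t tt)
... | false | _  = none⇒count≡0 (p ∘ suc) (none ∘ suc)

count≡1⇒∃! : ∀ {N} (p : Fin N → Bool) → count p ≡ 1 →
             ∃ λ i → T (p i) × ∀ j → T (p j) → j ≡ i
count≡1⇒∃! {suc N} p c with p zero in eq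
... | true = zero , subst T (sym eq) tt , only-zero
  where
    only-zero : ∀ j → T (p j) → j ≡ zero
    only-zero zero    _ = refl
    only-zero (suc j) t = ⊥-elim (count≡0⇒none (p ∘ suc) (suc-injective c) j t)
... | false with count≡1⇒∃! (p ∘ suc) c
...   | i , pi , only-i = suc i , pi , only-suc-i
  where
    only-suc-i : ∀ j → T (p j) → j ≡ suc i
    only-suc-i zero    t = ⊥-elim (subst T eq t)
    only-suc-i (suc j) t = cong suc (only-i j t)

atMostOne⇒count≤1 : ∀ {N} (p : Fin N → Bool) {i} → (∀ j → T (p j) → j ≡ i) → count p ≤ 1
atMostOne⇒count≤1 {suc N} p {zero} only-zero
  with p zero | none⇒count≡0 (p ∘ suc) (λ j t → Fin.0≢1+n (sym (only-zero (suc j) t)))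
... | true  | rest≡0 = s≤s (≤-reflexive rest≡0)
... | false | rest≡0 = ≤-trans (≤-reflexive rest≡0) z≤n
atMostOne⇒count≤1 {suc N} p {suc i} only-suc-i with p zero in eq
... | true  = ⊥-elim (Fin.0≢1+n (only-suc-i zero (subst T (sym eq) tt)))
... | false = atMostOne⇒count≤1 (p ∘ suc) (λ j t → Fin.suc-injective (only-suc-i (suc j) t))

module _ {N : ℕ} (G : Graph N) where
  open Graph G using (adj)

  Adj-sym : ∀ {u v} → Adj G u v → Adj G v u
  Adj-sym {u} {v} = subst T (Graph.sym G u v)

  Adj-irrefl : ∀ {u} → ¬ Adj G u u
  Adj-irrefl {u} = subst T (Graph.irrefl G u)

  degree≡count : ∀ u → degree G u ≡ count (adj u)
  degree≡count u = cong sum (map-tabulate id (λ x → if adj u x then 1 else 0))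

  External⇒∃!neighbour : ∀ {u} → External G u → ∃ λ w → Adj G u w × ∀ x → Adj G u x → x ≡ w
  External⇒∃!neighbour {u} u-ext = count≡1⇒∃! (adj u) (trans (sym (degree≡count u)) u-ext)

  neighbours≡⇒degree≤1 : ∀ {u w} → (∀ x → Adj G u x → x ≡ w) → degree G u ≤ 1
  neighbours≡⇒degree≤1 {u} only-w =
    subst (_≤ 1) (sym (degree≡count u)) (atMostOne⇒count≤1 (adj u) only-w)

  External⇒¬Internal : ∀ {n u} → 2 ≤ n → External G u → ¬ Internal G n u
  External⇒¬Internal 2≤n u-ext u-int = <⇒≢ 2≤n (trans (sym u-ext) u-int)

  Acyclic : Set
  Acyclic = ∀ xs → ¬ IsCycle G xs

  reducedWalk⇒head∉tail : Acyclic → ∀ {z ys} → Linked (Adj G) (z ∷ ys) →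
                          AllTriples (λ x _ y → x ≢ y) (z ∷ ys) → Unique ys → z ∉ ys
  -- A first return to z after one, two or at least three steps contradicts, respectively,
  -- irreflexivity, reducedness or acyclicity.
  reducedWalk⇒head∉tail acyclic {z} walk reduced ys! z∈ys with ∈-∃++ z∈ys
  ... | [] , _ , refl = Adj-irrefl (Linked.head walk)
  ... | _ ∷ [] , _ , refl = proj₁ reduced refl
  ... | ys₁@(_ ∷ _ ∷ _) , _ , refl with Linked[x∷xs++y∷ys]⇒closed ys₁ walk
  ...   | cycle , zₗ , last≡ , zₗ-z =
    acyclic (z ∷ ys₁) (z , zₗ , s≤s (s≤s (s≤s z≤n)) , Unique[xs++y∷ys]⇒Unique[y∷xs] ys₁ ys! ,
                       cycle , refl , last≡ , zₗ-z)

  reducedWalk⇒unique : Acyclic → ∀ {xs} → Linked (Adj G) xs →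
                       AllTriples (λ x _ y → x ≢ y) xs → Unique xs
  reducedWalk⇒unique acyclic []  _ = []
  reducedWalk⇒unique acyclic [-] _ = [] ∷ []
  reducedWalk⇒unique acyclic {_ ∷ ys} walk@(_ ∷ walk′) reduced =
    ¬Any⇒All¬ ys (reducedWalk⇒head∉tail acyclic walk reduced ys!) ∷ ys!
    where
      ys! : Unique ys
      ys! = reducedWalk⇒unique acyclic walk′ (AllTriples-tail ys reduced)

module _ {N : ℕ} (G : Graph N) (n : ℕ) (o : Orientation G n) where

  σ-adjacent : ∀ {a b} → Internal G n b → Adj G a b → Adj G b (σ G n o b a)
  σ-adjacent {a} {b} b-int a-b = proj₁ (proj₂ o b b-int) a (Adj-sym G a-b)

  σ-fixedPointFree : 2 ≤ n → ∀ {a b} → Internal G n b → Adj G a b → σ G n o b a ≢ a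
  -- The neighbours of b form a single σ_b-orbit, so a fixed neighbour is the only one.
  σ-fixedPointFree 2≤n {a} {b} b-int a-b σba≡a =
    <⇒≱ 2≤n (subst (_≤ 1) b-int (neighbours≡⇒degree≤1 G only-a))
    where
      only-a : ∀ x → Adj G b x → x ≡ a
      only-a x b-x with proj₂ (proj₂ (proj₂ o b b-int)) a x (Adj-sym G a-b) b-x
      ... | k , σᵏa≡x = trans (sym σᵏa≡x) (^[]-fixed σba≡a k)

  wellOriented⇒reducedWalk : 2 ≤ n → ∀ {a b} r → Adj G a b → WellOriented G n o (a ∷ b ∷ r) →
                             Linked (Adj G) (a ∷ b ∷ r) × Reduced G n o (a ∷ b ∷ r)
  wellOriented⇒reducedWalk _   []      a-b _ = a-b ∷ [-] , tt
  wellOriented⇒reducedWalk 2≤n (_ ∷ r) a-b ((b-int , refl) , wo)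
    with wellOriented⇒reducedWalk 2≤n r (σ-adjacent b-int a-b) wo
  ... | walk , reduced = a-b ∷ walk , ≢-sym (σ-fixedPointFree 2≤n b-int a-b) , reduced

  -- orbitWalk l a b = (a, b, σ_b a, …), with l vertices after b.
  orbitSteps : ℕ → Fin N → Fin N → List (Fin N)
  orbitSteps zero    a b = []
  orbitSteps (suc l) a b = σ G n o b a ∷ orbitSteps l b (σ G n o b a)

  orbitWalk : ℕ → Fin N → Fin N → List (Fin N)
  orbitWalk l a b = a ∷ b ∷ orbitSteps l a b

  orbitEnd : ℕ → Fin N → Fin N → Fin N
  orbitEnd zero    a b = b
  orbitEnd (suc l) a b = orbitEnd l b (σ G n o b a)

  length-orbitSteps : ∀ l a b → length (orbitSteps l a b) ≡ l
  length-orbitSteps zero    a b = refl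
  length-orbitSteps (suc l) a b = cong suc (length-orbitSteps l b (σ G n o b a))

  last-orbitWalk : ∀ l a b → last (orbitWalk l a b) ≡ just (orbitEnd l a b)
  last-orbitWalk zero    a b = refl
  last-orbitWalk (suc l) a b = last-orbitWalk l b (σ G n o b a)

  Exit : Fin N → Fin N → Set
  Exit a b = ∃ λ l → WellOriented G n o (orbitWalk l a b) × ¬ Internal G n (orbitEnd l a b)

  exit⊎wellOriented : ∀ k a b → Exit a b ⊎ WellOriented G n o (orbitWalk k a b)
  exit⊎wellOriented zero    a b = inj₂ tt
  exit⊎wellOriented (suc k) a b with degree G b ≟ n
  ... | no  b-ext = inj₁ (0 , tt , b-ext)
  ... | yes b-int = Sum.map (λ (l , wo , end) → suc l , ((b-int , refl) , wo) , end)
                            ((b-int , refl) ,_)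
                            (exit⊎wellOriented k b (σ G n o b a))

  orbitWalk-exits : 2 ≤ n → Acyclic G → ∀ {a b} → Adj G a b → Exit a b
  orbitWalk-exits 2≤n acyclic {a} {b} a-b with exit⊎wellOriented N a b
  ... | inj₁ e  = e
  ... | inj₂ wo = ⊥-elim (1+n≰n (≤-trans (n≤1+n _) 2+N≤N))
    where
      walk-unique : Unique (orbitWalk N a b)
      walk-unique = uncurry (reducedWalk⇒unique G acyclic)
                            (wellOriented⇒reducedWalk 2≤n (orbitSteps N a b) a-b wo)

      2+N≤N : 2 + N ≤ N
      2+N≤N = subst (λ k → 2 + k ≤ N) (length-orbitSteps N a b) (Unique⇒length≤ walk-unique)

  wellOrientedWalk≡orbitWalk : ∀ l {a b} r {w} →
    WellOriented G n o (orbitWalk l a b) → ¬ Internal G n (orbitEnd l a b) →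
    WellOriented G n o (a ∷ b ∷ r) → last (a ∷ b ∷ r) ≡ just w → ¬ Internal G n w →
    a ∷ b ∷ r ≡ orbitWalk l a b
  wellOrientedWalk≡orbitWalk zero    []      _ _ _ _ _ = refl
  wellOrientedWalk≡orbitWalk zero    (_ ∷ _) _ end ((b-int , _) , _) _ _ = ⊥-elim (end b-int)
  wellOrientedWalk≡orbitWalk (suc l) []      ((b-int , _) , _) _ _ refl w-int = ⊥-elim (w-int b-int)
  wellOrientedWalk≡orbitWalk (suc l) {a} (_ ∷ r) (_ , wo) end ((_ , refl) , wo′) last≡ w-int =
    cong (a ∷_) (wellOrientedWalk≡orbitWalk l r wo end wo′ last≡ w-int)

lemma3p20 : (n m N : ℕ) → 2 ≤ n → 1 ≤ m → (G : Graph N) → InBi G m n →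
    (o : Orientation G n) → (v : Fin N) → External G v →
    Σ (Fin N) λ w → Σ (List (Fin N)) λ p →
      (External G w × w ≢ v × RWOPath G n o v w p) ×
      (∀ w′ p′ → External G w′ → w′ ≢ v → RWOPath G n o v w′ p′ →
        w′ ≡ w × p′ ≡ p)
lemma3p20 n m N 2≤n _ G ((_ , acyclic) , valences , _) o v v-ext
  with External⇒∃!neighbour G v-ext
... | u , v-u , only-u with orbitWalk-exits G n o 2≤n acyclic v-u
... | l , wo , w-int with wellOriented⇒reducedWalk G n o 2≤n (orbitSteps G n o l v u) v-u wo
... | walk , reduced =
  w , orbitWalk G n o l v u ,
  (w-ext , ≢-sym v≢w , (refl , last-orbitWalk G n o l v u , walk) , reduced , wo) , uniqueness
  where
    w : Fin N
    w = orbitEnd G n o l v u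

    w-ext : External G w
    w-ext = [ id , ⊥-elim ∘ w-int ]′ (valences w)

    v≢w : v ≢ w
    v≢w with reducedWalk⇒unique G acyclic walk reduced
    ... | v∉ ∷ _ = All-last v∉ (last-orbitWalk G n o l v u)

    uniqueness : ∀ w′ p′ → External G w′ → w′ ≢ v → RWOPath G n o v w′ p′ →
                 w′ ≡ w × p′ ≡ orbitWalk G n o l v u
    uniqueness w′ [] _ _ ((() , _) , _)
    uniqueness w′ (_ ∷ []) _ w′≢v ((refl , refl , _) , _) = ⊥-elim (w′≢v refl)
    uniqueness w′ (_ ∷ z ∷ r) w′-ext _ ((refl , last≡ , v-z ∷ _) , _ , wo′)
      with only-u z v-z
    ... | refl
      with wellOrientedWalk≡orbitWalk G n o l r wo w-int wo′ last≡ (External⇒¬Internal G 2≤n w′-ext)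
    ... | refl = sym (just-injective (trans (sym (last-orbitWalk G n o l v u)) last≡)) , refl
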